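{- Let $Q$ be a positive integer and let $k$ be any positive integer. Then for every index $i\in\mathbb{Z}$, \[ \nu_k(\gamma_i)=\left(\frac{2k-1}{2}\right)K_{k-1}\left(-\nu_2(\gamma_i),\,\nu_2(\gamma_{i+1}),\,\ldots,\,(-1)^{k-1}\nu_2(\gamma_{i+k-2})\right), \] where the $j$-th argument of $K_{k-1}$ is $(-1)^{j}\nu_2(\gamma_{i+j-1})$ for $1\le j\le k-1$ (for $k=1$ the right-hand side is $\left(\frac{1}{2}\right)K_0(\cdot)=1$).
   Context: For $Q\in\mathbb{N}$, the Farey fractions of order $Q$ are $\mathcal{F}_Q=\{a/q\in\mathbb{Q}: 1\le q\le Q,\ 0<a\le q,\ \gcd(a,q)=1\}$. Write $\mathcal{F}_Q=\{\gamma_1,\ldots,\gamma_{N(Q)}\}$ with $1/Q=\gamma_1<\gamma_2<\cdots<\gamma_{N(Q)}=1$, and extend to all $i\in\mathbb{Z}$ by $\gamma_{i+N(Q)}=\gamma_i+1$. Write $\gamma_i=p_i/q_i$ in lowest terms with $q_i>0$. For a positive integer $k$, the $k$-index of $\gamma_i$ is $\nu_k(\gamma_i)=p_{i+k-1}q_{i-1}-p_{i-1}q_{i+k-1}$ (this depends on $Q$). The convergent polynomials are defined by $K_0(\cdot)=1$, $K_1(x_1)=x_1$, and $K_n(x_1,\ldots,x_n)=x_nK_{n-1}(x_1,\ldots,x_{n-1})+K_{n-2}(x_1,\ldots,x_{n-2})$ for $n\ge 2$. The symbol $\left(\frac{n}{2}\right)$ is the Kronecker symbol: it equals $0$ if $n$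 is even, $1$ if $n\equiv\pm1\pmod 8$, and $-1$ if $n\equiv\pm3\pmod 8$. -}

module Defs where

open import Data.Nat as ℕ using (ℕ; zero; suc)
open import Data.Nat.GCD using (gcd)
open import Data.Integer as ℤ using (ℤ; +_; -[1+_]; _+_; _-_; _*_; -_)
open import Data.Integer.DivMod using (_/ℕ_; _%ℕ_)
open import Data.Rational as ℚ using (ℚ; ↥_; ↧_; normalize)
open import Data.Rational.Properties using (≤-decTotalOrder)
open import Data.List using (List; []; _∷_; _++_; concatMap; filterᵇ; map; length; upTo)
open import Data.Bool using (Bool)
open import Data.Product using (_×_)

open import Data.List.Sort.InsertionSort ≤-decTotalOrder using (sort)

-- Unsorted list of the elements a/q of F_Q : 1 ≤ q ≤ Q, 0 < a ≤ q, gcd(a,q) = 1.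
-- (each fraction appears exactly once since we keep only reduced pairs)
fareyUnsorted : ℕ → List ℚ
fareyUnsorted Q =
  concatMap (λ q′ → let q = suc q′ in
     map (λ a′ → normalize (suc a′) q)
         (filterᵇ (λ a′ → gcd (suc a′) q ℕ.≡ᵇ 1) (upTo q)))
   (upTo Q)

-- F_Q listed increasingly: γ_1 < γ_2 < ... < γ_N(Q)  (0-based list positions)
farey : ℕ → List ℚ
farey Q = sort (fareyUnsorted Q)

lookupD : ℚ → List ℚ → ℕ → ℚ
lookupD x xs zero = x
lookupD x [] (suc n) = x
lookupD x (y ∷ ys) (suc n) = lookupD y ys n

-- (p_i , q_i) for γ_i, i ∈ ℤ, with γ_{i+N} = γ_i + 1.
-- Write i - 1 = m N + r with 0 ≤ r < N; then γ_i = γ_{r+1} + m,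
-- so p_i = p_{r+1} + m q_{r+1} and q_i = q_{r+1}.
-- (For the empty list, which only occurs when Q = 0, a dummy value.)
pFar : ℕ → ℤ → ℤ
pFar Q i with farey Q
... | [] = + 0
... | x ∷ xs = let N = suc (length xs) ; j = i - + 1 ; m = j /ℕ N ; r = j %ℕ N
                   γ = lookupD x xs r
               in ↥ γ + m * ↧ γ

qFar : ℕ → ℤ → ℤ
qFar Q i with farey Q
... | [] = + 1
... | x ∷ xs = let N = suc (length xs) ; j = i - + 1 ; r = j %ℕ N
               in ↧ lookupD x xs r

ν : ℕ → ℕ → ℤ → ℤ
ν Q k i = pFar Q (i + + k - + 1) * qFar Q (i - + 1) - pFar Q (i - + 1) * qFar Q (i + + k - + 1)

-- Convergent polynomials K_n(x_1,…,x_n); the arguments are given as a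
-- 1-indexed sequence x : ℕ → ℤ (only x 1, …, x n are used).
K : ℕ → (ℕ → ℤ) → ℤ
K zero x = + 1
K (suc zero) x = x 1
K (suc (suc n)) x = x (suc (suc n)) * K (suc n) x + K n x

kron2 : ℕ → ℤ
kron2 n with n ℕ.% 8
... | 1 = + 1
... | 7 = + 1
... | 3 = - + 1
... | 5 = - + 1
... | _ = + 0

sgn : ℕ → ℤ
sgn zero = + 1
sgn (suc j) = - sgn j

module Submission where

-- ν_k(γ_i) is the determinant D(i−1, i+k−1) of two terms of the periodically extended
-- Farey sequence.  The proof separates algebra from arithmetic.
--
-- ContinuantFormula: for ANY two integer sequences P, R whose consecutive determinants
-- D(j, j+1) all equal 1 ("unimodular"), the Plücker relation gives the recurrence
-- ν_{k+3}(γ_i) = ν_2(γ_{i+k+1}) ν_{k+2}(γ_i) − ν_{k+1}(γ_i), and an induction comparing it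
-- with the recurrence of the convergent polynomials K_n, keeping track of the signs
-- (−1)^j and of (2k+1 / 2), yields the stated formula.

open import Defs

module ContinuantFormula where

  open import Data.Nat as ℕ using (ℕ; zero; suc)
  import Data.Nat.Properties as ℕP
  import Data.Nat.DivMod as ℕD
  open import Data.Integer using (ℤ; +_; _+_; _-_; _*_; -_)
  import Data.Integer.Properties as ℤP
  open import Data.Integer.Tactic.RingSolver using (solve-∀)
  open import Data.Product using (_×_; _,_; proj₁)
  open import Relation.Binary.PropositionalEquality
  open ≡-Reasoning

  Det : (ℤ → ℤ) → (ℤ → ℤ) → ℤ → ℤ → ℤ
  Det P R s t = P t * R s - P s * R t

  Unimodular : (ℤ → ℤ) → (ℤ → ℤ) → Set
  Unimodular P R = ∀ j → Det P R j (j + + 1) ≡ + 1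

  unimodular-resp : ∀ {P P′ R R′} → (∀ i → P i ≡ P′ i) → (∀ i → R i ≡ R′ i) → Unimodular P′ R′ → Unimodular P R
  unimodular-resp {P} {P′} {R} {R′} P≗P′ R≗R′ unimodular j = begin
    P (j + + 1) * R j - P j * R (j + + 1)       ≡⟨ cong₂ _-_ (cong₂ _*_ (P≗P′ _) (R≗R′ j)) (cong₂ _*_ (P≗P′ j) (R≗R′ _)) ⟩
    P′ (j + + 1) * R′ j - P′ j * R′ (j + + 1)   ≡⟨ unimodular j ⟩
    + 1                                         ∎

  plücker : ∀ P R s a b c →
    Det P R s c * Det P R a b ≡ Det P R a c * Det P R s b - Det P R s a * Det P R b c
  plücker P R s a b c = identity (P a) (R a) (P b) (R b) (P c) (R c) (P s) (R s)
    where
    identity : ∀ pa ra pb rb pc rc ps rs →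
      (pc * rs - ps * rc) * (pb * ra - pa * rb)
        ≡ (pc * ra - pa * rc) * (pb * rs - ps * rb) - (pa * rs - ps * ra) * (pc * rb - pb * rc)
    identity = solve-∀

  kron2-mod8 : ∀ m n → m ℕ.% 8 ≡ n ℕ.% 8 → kron2 m ≡ kron2 n
  kron2-mod8 m n eq with m ℕ.% 8 | n ℕ.% 8 | eq
  ... | r | .r | refl = refl

  χ : ℕ → ℤ
  χ k = kron2 (suc (2 ℕ.* k))

  χ-periodic : ∀ k → χ (4 ℕ.+ k) ≡ χ k
  χ-periodic k = kron2-mod8 (suc (2 ℕ.* (4 ℕ.+ k))) (suc (2 ℕ.* k)) (begin
    suc (2 ℕ.* (4 ℕ.+ k)) ℕ.% 8    ≡⟨ cong (λ n → suc n ℕ.% 8)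
                                        (trans (ℕP.*-distribˡ-+ 2 4 k) (ℕP.+-comm 8 (2 ℕ.* k))) ⟩
    (suc (2 ℕ.* k) ℕ.+ 8) ℕ.% 8    ≡⟨ ℕD.[m+n]%n≡m%n (suc (2 ℕ.* k)) 8 ⟩
    suc (2 ℕ.* k) ℕ.% 8            ∎)

  χ-antiperiodic : ∀ k → χ (2 ℕ.+ k) ≡ - χ k
  χ-antiperiodic 0 = refl
  χ-antiperiodic 1 = refl
  χ-antiperiodic (suc (suc k)) = begin
    χ (4 ℕ.+ k)           ≡⟨ χ-periodic k ⟩
    χ k                   ≡⟨ sym (ℤP.neg-involutive (χ k)) ⟩
    - - χ k               ≡⟨ cong -_ (sym (χ-antiperiodic k)) ⟩
    - χ (2 ℕ.+ k)         ∎

  sgn-twice : ∀ k → sgn (2 ℕ.+ k) ≡ sgn k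
  sgn-twice k = ℤP.neg-involutive (sgn k)

  χ-step : ∀ k → χ (suc k) ≡ - (sgn k * χ k)
  χ-step 0 = refl
  χ-step 1 = refl
  χ-step (suc (suc k)) = begin
    χ (2 ℕ.+ suc k)               ≡⟨ χ-antiperiodic (suc k) ⟩
    - χ (suc k)                   ≡⟨ cong -_ (χ-step k) ⟩
    - - (sgn k * χ k)             ≡⟨ regroup (sgn k) (χ k) ⟩
    - (sgn k * - χ k)             ≡⟨ cong₂ (λ s c → - (s * c)) (sym (sgn-twice k)) (sym (χ-antiperiodic k)) ⟩
    - (sgn (2 ℕ.+ k) * χ (2 ℕ.+ k)) ∎
    where
    regroup : ∀ s c → - - (s * c) ≡ - (s * - c)
    regroup = solve-∀

  module _ {P R : ℤ → ℤ} (unimodular : Unimodular P R) where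

    D : ℤ → ℤ → ℤ
    D = Det P R

    index : ℕ → ℤ → ℤ
    index k i = D (i - + 1) (i + + k - + 1)

    det-recurrence : ∀ s t → D s (t + + 1) ≡ D (t - + 1) (t + + 1) * D s t - D s (t - + 1)
    det-recurrence s t = begin
      D s (t + + 1)                                  ≡⟨ sym (ℤP.*-identityʳ _) ⟩
      D s (t + + 1) * + 1                            ≡⟨ cong (D s (t + + 1) *_) (sym previous) ⟩
      D s (t + + 1) * D (t - + 1) t                  ≡⟨ plücker P R s (t - + 1) t (t + + 1) ⟩
      D (t - + 1) (t + + 1) * D s t - D s (t - + 1) * D t (t + + 1)
                                                     ≡⟨ cong (λ u → D (t - + 1) (t + + 1) * D s t - D s (t - + 1) * u)
                                                          (unimodular t) ⟩
      D (t - + 1) (t + + 1) * D s t - D s (t - + 1) * + 1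
                                                     ≡⟨ cong (λ u → D (t - + 1) (t + + 1) * D s t - u) (ℤP.*-identityʳ _) ⟩
      D (t - + 1) (t + + 1) * D s t - D s (t - + 1)  ∎
      where
      pred-suc : ∀ t → t - + 1 + + 1 ≡ t
      pred-suc = solve-∀
      previous : D (t - + 1) t ≡ + 1
      previous = subst (λ u → D (t - + 1) u ≡ + 1) (pred-suc t) (unimodular (t - + 1))

    index-recurrence : ∀ k i →
      index (3 ℕ.+ k) i ≡ index 2 (i + + (2 ℕ.+ k) - + 1) * index (2 ℕ.+ k) i - index (1 ℕ.+ k) i
    index-recurrence k i = begin
      D s (i + + (3 ℕ.+ k) - + 1)                    ≡⟨ cong (D s) (shift-up i (+ (2 ℕ.+ k))) ⟩
      D s (t + + 1)                                  ≡⟨ det-recurrence s t ⟩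
      D (t - + 1) (t + + 1) * D s t - D s (t - + 1)  ≡⟨ cong₂ (λ u v → D (t - + 1) u * D s t - D s v)
                                                          (sym (two-minus-one t)) (shift-down i (+ (1 ℕ.+ k))) ⟩
      D (t - + 1) (t + + 2 - + 1) * D s t - D s (i + + (1 ℕ.+ k) - + 1) ∎
      where
      s = i - + 1
      t = i + + (2 ℕ.+ k) - + 1
      shift-up : ∀ i m → i + (+ 1 + m) - + 1 ≡ (i + m - + 1) + + 1
      shift-up = solve-∀
      shift-down : ∀ i m → i + (+ 1 + m) - + 1 - + 1 ≡ i + m - + 1
      shift-down = solve-∀
      two-minus-one : ∀ t → t + + 2 - + 1 ≡ t + + 1
      two-minus-one = solve-∀

    arguments : ℤ → ℕ → ℤ
    arguments i j = sgn j * index 2 (i + + j - + 1)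

    -- Main induction: ν_{k+1}(γ_i) = (2k+1 / 2) K_k(arguments), proved together with the next case.
    index-formula-pair : ∀ i k →
      (index (1 ℕ.+ k) i ≡ χ k * K k (arguments i)) × (index (2 ℕ.+ k) i ≡ χ (1 ℕ.+ k) * K (1 ℕ.+ k) (arguments i))
    index-formula-pair i zero = index-one , index-two
      where
      index-one : index 1 i ≡ + 1
      index-one = subst (λ u → D (i - + 1) u ≡ + 1) (pred-suc i) (unimodular (i - + 1))
        where
        pred-suc : ∀ i → i - + 1 + + 1 ≡ i + + 1 - + 1
        pred-suc = solve-∀
      -- (3/2) = −1 and (−1)^1 = −1 cancel.
      index-two : index 2 i ≡ χ 1 * K 1 (arguments i)
      index-two = trans (cong (index 2) (sym (suc-pred i))) (double-negation (index 2 (i + + 1 - + 1)))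
        where
        suc-pred : ∀ i → i + + 1 - + 1 ≡ i
        suc-pred = solve-∀
        double-negation : ∀ a → a ≡ - + 1 * (- + 1 * a)
        double-negation = solve-∀
    index-formula-pair i (suc k) with index-formula-pair i k
    ... | previous , current = current , next
      where
      ν₂ = index 2 (i + + (2 ℕ.+ k) - + 1)
      K₀ = K k (arguments i)
      K₁ = K (1 ℕ.+ k) (arguments i)
      rearrange : ∀ ν s c K₁ K₀ → ν * (- (s * c) * K₁) - c * K₀ ≡ - c * (s * ν * K₁ + K₀)
      rearrange = solve-∀
      next : index (3 ℕ.+ k) i ≡ χ (2 ℕ.+ k) * K (2 ℕ.+ k) (arguments i)
      next = begin
        index (3 ℕ.+ k) i                       ≡⟨ index-recurrence k i ⟩
        ν₂ * index (2 ℕ.+ k) i - index (1 ℕ.+ k) i ≡⟨ cong₂ (λ u v → ν₂ * u - v) current previous ⟩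
        ν₂ * (χ (1 ℕ.+ k) * K₁) - χ k * K₀      ≡⟨ cong (λ c → ν₂ * (c * K₁) - χ k * K₀) (χ-step k) ⟩
        ν₂ * (- (sgn k * χ k) * K₁) - χ k * K₀  ≡⟨ rearrange ν₂ (sgn k) (χ k) K₁ K₀ ⟩
        - χ k * (sgn k * ν₂ * K₁ + K₀)          ≡⟨ cong₂ (λ c s → c * (s * ν₂ * K₁ + K₀))
                                                     (sym (χ-antiperiodic k)) (sym (sgn-twice k)) ⟩
        χ (2 ℕ.+ k) * (sgn (2 ℕ.+ k) * ν₂ * K₁ + K₀) ∎

    index-formula : ∀ k → k ℕ.≥ 1 → ∀ i →
      index k i ≡ kron2 (2 ℕ.* k ℕ.∸ 1) * K (k ℕ.∸ 1) (arguments i)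
    index-formula (suc k) _ i = begin
      index (suc k) i                           ≡⟨ proj₁ (index-formula-pair i k) ⟩
      χ k * K k (arguments i)                   ≡⟨ cong (λ n → kron2 n * K k (arguments i)) (sym (ℕP.+-suc k (k ℕ.+ 0))) ⟩
      kron2 (2 ℕ.* suc k ℕ.∸ 1) * K k (arguments i) ∎

module IntegerDivision where

  import Data.Nat as ℕ
  open import Data.Integer using (+_; _+_; _*_; _≤_; _<_; +<+)
  import Data.Integer.Properties as ℤP
  open import Data.Integer.DivMod using (_/ℕ_; _%ℕ_; a≡a%ℕn+[a/ℕn]*n; [n/ℕd]*d≤n; n<s[n/ℕd]*d)
  open import Algebra.Bundles using (AbelianGroup)
  open import Algebra.Properties.Group (AbelianGroup.group ℤP.+-0-abelianGroup) using (∙-cancelʳ)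
  open import Data.Product using (_×_; _,_)
  open import Data.Empty using (⊥-elim)
  open import Relation.Binary.Definitions using (tri<; tri≈; tri>)
  open import Relation.Binary.PropositionalEquality

  -- The quotient n /ℕ N is the unique m with m N ≤ n < (m + 1) N: a smaller or larger
  -- quotient q would give (q + 1) N ≤ m N ≤ n or (m + 1) N ≤ q N ≤ n.
  quotient-unique : ∀ n N .{{_ : ℕ.NonZero N}} m → m * + N ≤ n → n < (+ 1 + m) * + N → n /ℕ N ≡ m
  quotient-unique n N m lower upper with ℤP.<-cmp (n /ℕ N) m
  ... | tri≈ _ q≡m _ = q≡m
  ... | tri< q<m _ _ = ⊥-elim (ℤP.<-irrefl refl (ℤP.<-≤-trans (n<s[n/ℕd]*d n N)
                          (ℤP.≤-trans (ℤP.*-monoʳ-≤-nonNeg (+ N) (ℤP.i<j⇒suc[i]≤j q<m)) lower)))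
  ... | tri> _ _ m<q = ⊥-elim (ℤP.<-irrefl refl (ℤP.<-≤-trans upper
                          (ℤP.≤-trans (ℤP.*-monoʳ-≤-nonNeg (+ N) (ℤP.i<j⇒suc[i]≤j m<q)) ([n/ℕd]*d≤n n N))))

  divmod-unique : ∀ n N .{{_ : ℕ.NonZero N}} r m → r ℕ.< N → n ≡ + r + m * + N →
                  (n %ℕ N ≡ r) × (n /ℕ N ≡ m)
  divmod-unique n N r m r<N n≡r+mN = remainder , quotient
    where
    quotient : n /ℕ N ≡ m
    quotient = quotient-unique n N m
      (subst (m * + N ≤_) (sym n≡r+mN) (ℤP.i≤j+i (m * + N) (+ r)))
      (subst₂ _<_ (sym n≡r+mN) (sym (ℤP.suc-* m (+ N))) (ℤP.+-monoˡ-< (m * + N) (+<+ r<N)))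
    remainder : n %ℕ N ≡ r
    remainder = ℤP.+-injective (∙-cancelʳ (m * + N) (+ (n %ℕ N)) (+ r)
      (trans (cong (λ q → + (n %ℕ N) + q * + N) (sym quotient)) (trans (sym (a≡a%ℕn+[a/ℕn]*n n N)) n≡r+mN)))

module PeriodicExtension where

  open import Data.Nat as ℕ using (suc)
  import Data.Nat.Properties as ℕP
  open import Data.Integer using (ℤ; +_; _+_; _-_; _*_)
  open import Data.Integer.DivMod using (_/ℕ_; _%ℕ_; a≡a%ℕn+[a/ℕn]*n; n%ℕd<d)
  open import Data.Integer.Tactic.RingSolver using (solve-∀)
  open import Data.Rational using (ℚ; ↥_; ↧_; 1ℚ)
  open import Data.List using (List; []; _∷_; length)
  open import Data.Product using (_×_; _,_)
  open import Relation.Nullary using (yes; no)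
  open import Relation.Binary.PropositionalEquality
  open ≡-Reasoning
  open ContinuantFormula using (Det; Unimodular)
  open IntegerDivision using (divmod-unique)

  det : ℚ → ℚ → ℤ
  det u v = ↥ v * ↧ u - ↥ u * ↧ v

  numer : List ℚ → ℤ → ℤ
  numer [] i = + 0
  numer (x ∷ xs) i = let N = suc (length xs) ; j = i - + 1 ; m = j /ℕ N ; r = j %ℕ N
                         γ = lookupD x xs r
                     in ↥ γ + m * ↧ γ

  denom : List ℚ → ℤ → ℤ
  denom [] i = + 1
  denom (x ∷ xs) i = let N = suc (length xs) ; j = i - + 1 ; r = j %ℕ N
                     in ↧ lookupD x xs r

  pFar≡numer : ∀ Q i → pFar Q i ≡ numer (farey Q) i
  pFar≡numer Q i with farey Q
  ... | [] = refl
  ... | x ∷ xs = refl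

  qFar≡denom : ∀ Q i → qFar Q i ≡ denom (farey Q) i
  qFar≡denom Q i with farey Q
  ... | [] = refl
  ... | x ∷ xs = refl

  module _ (x : ℚ) (xs : List ℚ) where

    private
      N = suc (length xs)
      γ = lookupD x xs

    shape : ∀ i r m → r ℕ.< N → i - + 1 ≡ + r + m * + N →
            (numer (x ∷ xs) i ≡ ↥ γ r + m * ↧ γ r) × (denom (x ∷ xs) i ≡ ↧ γ r)
    shape i r m r<N eq with divmod-unique (i - + 1) N r m r<N eq
    ... | rem≡r , quot≡m = cong₂ (λ r m → ↥ γ r + m * ↧ γ r) rem≡r quot≡m , cong (λ r → ↧ γ r) rem≡r

    -- The periodic extension is unimodular as soon as the list is, its last term is 1 and
    -- its first term has numerator 1 (so that the pair γ_N = 1, γ_{N+1} = γ_1 + 1 is unimodular).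
    periodic-unimodular : (∀ r → suc r ℕ.< N → det (γ r) (γ (suc r)) ≡ + 1) → ↥ x ≡ + 1 → γ (length xs) ≡ 1ℚ →
                          Unimodular (numer (x ∷ xs)) (denom (x ∷ xs))
    periodic-unimodular consecutive head-numer last≡1 i =
      at-position ((i - + 1) %ℕ N) ((i - + 1) /ℕ N) (n%ℕd<d (i - + 1) N) (a≡a%ℕn+[a/ℕn]*n (i - + 1) N)
      where
      next-index : ∀ r m → i - + 1 ≡ r + m → i + + 1 - + 1 ≡ + 1 + r + m
      next-index r m eq = trans (regroup i) (trans (cong (_+ + 1) eq) (swap r m))
        where
        regroup : ∀ i → i + + 1 - + 1 ≡ i - + 1 + + 1
        regroup = solve-∀
        swap : ∀ r m → r + m + + 1 ≡ + 1 + r + m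
        swap = solve-∀
      wrap-index : ∀ m → i - + 1 ≡ + length xs + m * + N → i + + 1 - + 1 ≡ + 0 + (m + + 1) * + N
      wrap-index m eq = trans (next-index (+ length xs) (m * + N) eq) (carry (+ N) m)
        where
        carry : ∀ n m → n + m * n ≡ + 0 + (m + + 1) * n
        carry = solve-∀
      Det-at : ℤ
      Det-at = Det (numer (x ∷ xs)) (denom (x ∷ xs)) i (i + + 1)

      Det-via : ∀ {p q p′ q′} → (numer (x ∷ xs) i ≡ p) × (denom (x ∷ xs) i ≡ q) →
                (numer (x ∷ xs) (i + + 1) ≡ p′) × (denom (x ∷ xs) (i + + 1) ≡ q′) → Det-at ≡ p′ * q - p * q′
      Det-via (refl , refl) (refl , refl) = refl

      -- γ_i and γ_{i+1} lie in the same period: the determinant is that of γ_{1+r}, γ_{2+r}.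
      inside : ∀ r m → suc r ℕ.< N → i - + 1 ≡ + r + m * + N → Det-at ≡ + 1
      inside r m r+1<N eq = begin
        Det-at
          ≡⟨ Det-via (shape i r m (ℕP.<⇒≤ r+1<N) eq) (shape (i + + 1) (suc r) m r+1<N (next-index (+ r) (m * + N) eq)) ⟩
        (↥ γ (suc r) + m * ↧ γ (suc r)) * ↧ γ r - (↥ γ r + m * ↧ γ r) * ↧ γ (suc r)
          ≡⟨ translation-invariant (↥ γ r) (↧ γ r) (↥ γ (suc r)) (↧ γ (suc r)) m ⟩
        det (γ r) (γ (suc r))
          ≡⟨ consecutive r r+1<N ⟩
        + 1 ∎
        where
        translation-invariant : ∀ a b a′ b′ m → (a′ + m * b′) * b - (a + m * b) * b′ ≡ a′ * b - a * b′
        translation-invariant = solve-∀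

      -- γ_i = γ_N + m = 1 + m and γ_{i+1} = γ_1 + m + 1: the determinant is the numerator of γ_1.
      at-end : ∀ m → i - + 1 ≡ + length xs + m * + N → Det-at ≡ + 1
      at-end m eq = begin
        Det-at
          ≡⟨ Det-via (shape i (length xs) m ℕP.≤-refl eq) (shape (i + + 1) 0 (m + + 1) (ℕ.s≤s ℕ.z≤n) (wrap-index m eq)) ⟩
        (↥ x + (m + + 1) * ↧ x) * ↧ γ (length xs) - (↥ γ (length xs) + m * ↧ γ (length xs)) * ↧ x
          ≡⟨ cong (λ z → (↥ x + (m + + 1) * ↧ x) * ↧ z - (↥ z + m * ↧ z) * ↧ x) last≡1 ⟩
        (↥ x + (m + + 1) * ↧ x) * + 1 - (+ 1 + m * + 1) * ↧ x
          ≡⟨ wrap-around (↥ x) (↧ x) m ⟩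
        ↥ x
          ≡⟨ head-numer ⟩
        + 1 ∎
        where
        wrap-around : ∀ a b m → (a + (m + + 1) * b) * + 1 - (+ 1 + m * + 1) * b ≡ a
        wrap-around = solve-∀

      at-position : ∀ r m → r ℕ.< N → i - + 1 ≡ + r + m * + N → Det-at ≡ + 1
      at-position r m r<N eq with suc r ℕ.<? N
      ... | yes r+1<N = inside r m r+1<N eq
      ... | no r+1≮N with ℕP.≤-antisym r<N (ℕP.≮⇒≥ r+1≮N)
      ... | refl = at-end m eq

module SortedLists where

  open import Data.Nat as ℕ using (zero; suc)
  open import Data.Rational using (_≤_; _<_)
  import Data.Rational.Properties as ℚP
  open import Data.List using ([]; _∷_; length)
  open import Data.List.Relation.Unary.Linked using (Linked; _∷_)
  open import Data.List.Relation.Unary.AllPairs using (_∷_)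
  open import Data.List.Relation.Unary.All using (_∷_)
  open import Data.List.Relation.Unary.Unique.Propositional using (Unique)
  open import Data.List.Membership.Propositional using (_∈_)
  open import Data.List.Relation.Unary.Any using (here; there)
  open import Data.Sum using (_⊎_; inj₁; inj₂)
  open import Relation.Binary.PropositionalEquality

  lookup∈ : ∀ x xs r → lookupD x xs r ∈ x ∷ xs
  lookup∈ x xs zero = here refl
  lookup∈ x [] (suc r) = here refl
  lookup∈ x (y ∷ ys) (suc r) = there (lookup∈ y ys r)

  head-least : ∀ {x xs z} → Linked _≤_ (x ∷ xs) → z ∈ x ∷ xs → x ≤ z
  head-least s (here refl) = ℚP.≤-refl
  head-least (x≤y ∷ s) (there z∈) = ℚP.≤-trans x≤y (head-least s z∈)

  last-greatest : ∀ {x xs z} → Linked _≤_ (x ∷ xs) → z ∈ x ∷ xs → z ≤ lookupD x xs (length xs)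
  last-greatest {xs = []} s (here refl) = ℚP.≤-refl
  last-greatest {xs = y ∷ ys} (x≤y ∷ s) (here refl) = ℚP.≤-trans x≤y (last-greatest s (here refl))
  last-greatest {xs = y ∷ ys} (x≤y ∷ s) (there z∈) = last-greatest s z∈

  consecutive-< : ∀ {x xs} → Linked _≤_ (x ∷ xs) → Unique (x ∷ xs) → ∀ r → suc r ℕ.< suc (length xs) →
                  lookupD x xs r < lookupD x xs (suc r)
  consecutive-< {xs = []} s u r (ℕ.s≤s ())
  consecutive-< {xs = y ∷ ys} (x≤y ∷ s) ((x≢y ∷ _) ∷ u) zero _ =
    ℚP.≰⇒> (λ y≤x → x≢y (ℚP.≤-antisym x≤y y≤x))
  consecutive-< {xs = y ∷ ys} (_ ∷ s) (_ ∷ u) (suc r) (ℕ.s≤s r+1<N) = consecutive-< s u r r+1<N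

  no-entry-between : ∀ {x xs} → Linked _≤_ (x ∷ xs) → ∀ r → suc r ℕ.< suc (length xs) → ∀ {z} → z ∈ x ∷ xs →
                     z ≤ lookupD x xs r ⊎ lookupD x xs (suc r) ≤ z
  no-entry-between {xs = []} s r (ℕ.s≤s ())
  no-entry-between {xs = y ∷ ys} (x≤y ∷ s) zero _ (here refl) = inj₁ ℚP.≤-refl
  no-entry-between {xs = y ∷ ys} (x≤y ∷ s) zero _ (there z∈) = inj₂ (head-least s z∈)
  no-entry-between {xs = y ∷ ys} (x≤y ∷ s) (suc r) _ (here refl) =
    inj₁ (ℚP.≤-trans x≤y (head-least s (lookup∈ y ys r)))
  no-entry-between {xs = y ∷ ys} (x≤y ∷ s) (suc r) (ℕ.s≤s r+1<N) (there z∈) = no-entry-between s r r+1<N z∈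

module FareySet where

  open import Data.Nat as ℕ using (ℕ; suc)
  import Data.Nat.Properties as ℕP
  open import Data.Nat.GCD using (gcd)
  import Data.Nat.Coprimality as Coprimality
  open import Data.Integer as ℤ using (+_; +≤+)
  import Data.Integer.Properties as ℤP
  open import Data.Rational as ℚ using (ℚ; ↥_; ↧_; mkℚ; normalize; 1ℚ; *≤*)
  import Data.Rational.Properties as ℚP
  open import Data.List using (List; map; filterᵇ; upTo)
  open import Data.List.Properties using (map-∘; map-cong-local)
  open import Data.List.Membership.Propositional using (_∈_; find; lose)
  open import Data.List.Membership.Propositional.Properties
  import Data.List.Relation.Unary.All as All
  import Data.List.Relation.Unary.All.Properties as AllP
  import Data.List.Relation.Unary.AllPairs as AllPairs
  import Data.List.Relation.Unary.AllPairs.Properties as AllPairsP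
  open import Data.List.Relation.Unary.Linked using (Linked)
  open import Data.List.Relation.Unary.Unique.Propositional using (Unique)
  import Data.List.Relation.Unary.Unique.Propositional.Properties as UniqueP
  import Data.List.Relation.Binary.Permutation.Setoid.Properties as PermS
  open import Data.List.Relation.Binary.Disjoint.Propositional using (Disjoint)
  open import Data.List.Relation.Binary.Permutation.Propositional using (↭-sym; ↭⇒↭ₛ)
  import Data.List.Relation.Binary.Permutation.Propositional.Properties as PermP
  open import Data.List.Sort.InsertionSort.Properties ℚP.≤-decTotalOrder using (sort-↭; sort-↗)
  open import Data.Product using (Σ; _×_; _,_)
  open import Function using (_∘_)
  open import Relation.Binary.PropositionalEquality
  open import Relation.Nullary.Decidable using (Dec; T?)
  open import Data.Bool using (T)

  InFarey : ℕ → ℚ → Set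
  InFarey Q z = (+ 1 ℤ.≤ ↥ z) × (↥ z ℤ.≤ ↧ z) × (↧ z ℤ.≤ + Q)

  coprimeNumerators : ℕ → List ℕ
  coprimeNumerators q′ = filterᵇ (λ a′ → gcd (suc a′) (suc q′) ℕ.≡ᵇ 1) (upTo (suc q′))

  coprime-test : ∀ q′ a′ → Dec (T (gcd (suc a′) (suc q′) ℕ.≡ᵇ 1))
  coprime-test q′ a′ = T? (gcd (suc a′) (suc q′) ℕ.≡ᵇ 1)

  block : ℕ → List ℚ
  block q′ = map (λ a′ → normalize (suc a′) (suc q′)) (coprimeNumerators q′)

  coprime-numerator : ∀ {q′ a′} → a′ ∈ coprimeNumerators q′ →
                      (a′ ℕ.< suc q′) × (↥ normalize (suc a′) (suc q′) ≡ + suc a′) × (↧ normalize (suc a′) (suc q′) ≡ + suc q′)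
  coprime-numerator {q′} {a′} a′∈ with ∈-filter⁻ (coprime-test q′) {xs = upTo (suc q′)} a′∈
  ... | a′∈upTo , gcd≡1 = ∈-upTo⁻ a′∈upTo , cong ↥_ unchanged , cong ↧_ unchanged
    where
    unchanged = ℚP.normalize-coprime (Coprimality.gcd≡1⇒coprime (ℕP.≡ᵇ⇒≡ _ _ gcd≡1))

  ∈block⁻ : ∀ {q′ z} → z ∈ block q′ → Σ ℕ λ a′ → (a′ ℕ.< suc q′) × (↥ z ≡ + suc a′) × (↧ z ≡ + suc q′)
  ∈block⁻ {q′} z∈ with ∈-map⁻ (λ a′ → normalize (suc a′) (suc q′)) z∈
  ... | a′ , a′∈ , refl = a′ , coprime-numerator a′∈

  ∈unsorted⇒InFarey : ∀ {Q z} → z ∈ fareyUnsorted Q → InFarey Q z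
  ∈unsorted⇒InFarey {Q} z∈ with find (∈-concatMap⁻ block {xs = upTo Q} z∈)
  ... | q′ , q′∈ , z∈block with ∈block⁻ z∈block
  ... | a′ , a′<q , ↥z≡a , ↧z≡q = subst (+ 1 ℤ.≤_) (sym ↥z≡a) (+≤+ (ℕ.s≤s ℕ.z≤n)) ,
                                  subst₂ ℤ._≤_ (sym ↥z≡a) (sym ↧z≡q) (+≤+ a′<q) ,
                                  subst (ℤ._≤ + Q) (sym ↧z≡q) (+≤+ (∈-upTo⁻ q′∈))

  InFarey⇒∈unsorted : ∀ {Q z} → InFarey Q z → z ∈ fareyUnsorted Q
  InFarey⇒∈unsorted {Q} {mkℚ (+ suc a′) q′ coprime} (+≤+ (ℕ.s≤s _) , +≤+ a≤q , +≤+ q≤Q) =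
    ∈-concatMap⁺ block {xs = upTo Q} (lose (∈-upTo⁺ q≤Q) z∈block)
    where
    z∈block : mkℚ (+ suc a′) q′ coprime ∈ block q′
    z∈block = subst (_∈ block q′) (ℚP.normalize-coprime coprime)
      (∈-map⁺ (λ a′ → normalize (suc a′) (suc q′))
        (∈-filter⁺ (coprime-test q′) (∈-upTo⁺ a≤q)
          (ℕP.≡⇒≡ᵇ _ _ (Coprimality.coprime⇒gcd≡1 (Coprimality.recompute coprime)))))

  -- Within a block the numerators are distinct, hence so are the fractions.
  block-unique : ∀ q′ → Unique (block q′)
  block-unique q′ = UniqueP.map⁻ (subst Unique (sym numerators)
    (UniqueP.map⁺ (ℕP.suc-injective ∘ ℤP.+-injective)
      (UniqueP.filter⁺ (coprime-test q′) (UniqueP.upTo⁺ (suc q′)))))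
    where
    numerators : map ↥_ (block q′) ≡ map (λ a′ → + suc a′) (coprimeNumerators q′)
    numerators = trans (sym (map-∘ (coprimeNumerators q′)))
      (map-cong-local (All.tabulate (λ a′∈ → let _ , ↥≡ , _ = coprime-numerator a′∈ in ↥≡)))

  -- Different blocks have different denominators.
  blocks-disjoint : ∀ {q′ r′} → q′ ≢ r′ → Disjoint (block q′) (block r′)
  blocks-disjoint q′≢r′ (z∈q , z∈r) with ∈block⁻ z∈q | ∈block⁻ z∈r
  ... | _ , _ , _ , ↧z≡q | _ , _ , _ , ↧z≡r = q′≢r′ (ℕP.suc-injective (ℤP.+-injective (trans (sym ↧z≡q) ↧z≡r)))

  unsorted-unique : ∀ Q → Unique (fareyUnsorted Q)
  unsorted-unique Q = UniqueP.concat⁺ (AllP.map⁺ (All.tabulate (λ {q′} _ → block-unique q′)))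
                                      (AllPairsP.map⁺ (AllPairs.map blocks-disjoint (UniqueP.upTo⁺ Q)))

  farey-sorted : ∀ Q → Linked ℚ._≤_ (farey Q)
  farey-sorted Q = sort-↗ (fareyUnsorted Q)

  farey-unique : ∀ Q → Unique (farey Q)
  farey-unique Q = PermS.Unique-resp-↭ (setoid ℚ) (↭⇒↭ₛ (↭-sym (sort-↭ (fareyUnsorted Q)))) (unsorted-unique Q)

  ∈farey⇒InFarey : ∀ {Q z} → z ∈ farey Q → InFarey Q z
  ∈farey⇒InFarey {Q} z∈ = ∈unsorted⇒InFarey (PermP.∈-resp-↭ (sort-↭ (fareyUnsorted Q)) z∈)

  InFarey⇒∈farey : ∀ {Q z} → InFarey Q z → z ∈ farey Q
  InFarey⇒∈farey {Q} z∈F = PermP.∈-resp-↭ (↭-sym (sort-↭ (fareyUnsorted Q))) (InFarey⇒∈unsorted z∈F)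

  reciprocal : ℕ → ℚ
  reciprocal Q′ = mkℚ (+ 1) Q′ (Coprimality.1-coprimeTo (suc Q′))

  reciprocal-InFarey : ∀ Q′ → InFarey (suc Q′) (reciprocal Q′)
  reciprocal-InFarey Q′ = ℤP.≤-refl , +≤+ (ℕ.s≤s ℕ.z≤n) , ℤP.≤-refl

  one-InFarey : ∀ Q → 1 ℕ.≤ Q → InFarey Q 1ℚ
  one-InFarey Q Q≥1 = ℤP.≤-refl , ℤP.≤-refl , +≤+ Q≥1

  reciprocal-least : ∀ {Q′ z} → InFarey (suc Q′) z → reciprocal Q′ ℚ.≤ z
  reciprocal-least {Q′} {z} (1≤↥z , _ , ↧z≤Q) = *≤* (begin
    + 1 ℤ.* ↧ z      ≡⟨ ℤP.*-identityˡ (↧ z) ⟩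
    ↧ z              ≤⟨ ↧z≤Q ⟩
    + suc Q′         ≡⟨ ℤP.*-identityˡ (+ suc Q′) ⟨
    + 1 ℤ.* + suc Q′ ≤⟨ ℤP.*-monoʳ-≤-nonNeg (+ suc Q′) 1≤↥z ⟩
    ↥ z ℤ.* + suc Q′ ∎)
    where open ℤP.≤-Reasoning

  numerator≤denominator : ∀ {z} → z ℚ.≤ 1ℚ → ↥ z ℤ.≤ ↧ z
  numerator≤denominator {z} z≤1 =
    subst₂ ℤ._≤_ (ℤP.*-identityʳ (↥ z)) (ℤP.*-identityˡ (↧ z)) (ℚP.drop-*≤* z≤1)

  one-greatest : ∀ {Q z} → InFarey Q z → z ℚ.≤ 1ℚ
  one-greatest {z = z} (_ , ↥z≤↧z , _) =
    *≤* (subst₂ ℤ._≤_ (sym (ℤP.*-identityʳ (↥ z))) (sym (ℤP.*-identityˡ (↧ z))) ↥z≤↧z)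

module FareyNeighbours where

  open import Data.Nat as ℕ using (ℕ; zero; suc)
  import Data.Nat.Properties as ℕP
  open import Data.Nat.GCD using (module Bézout)
  open import Data.Nat.Coprimality as Coprimality using (Coprime)
  open import Data.Nat.Divisibility using (_∣_; ∣m+n∣m⇒∣n; ∣m⇒∣m*n; ∣n⇒∣m*n; ∣1⇒≡1)
  open import Data.Integer as ℤ using (ℤ; +_; -[1+_]; +≤+; +<+; _+_; _-_; _*_; -_; 0ℤ)
  import Data.Integer.Properties as ℤP
  open import Data.Integer.DivMod using (_/ℕ_; _%ℕ_; a≡a%ℕn+[a/ℕn]*n; n%ℕd<d)
  open import Data.Integer.Tactic.RingSolver using (solve-∀)
  open import Data.Rational as ℚ using (ℚ; ↥_; ↧_; mkℚ; *<*)
  import Data.Rational.Properties as ℚP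
  open import Data.Product using (Σ; _×_; _,_; proj₁; proj₂)
  open import Data.Sum using (_⊎_; inj₁; inj₂)
  open import Data.Empty using (⊥; ⊥-elim)
  open import Relation.Binary.Definitions using (Tri; tri<; tri≈; tri>)
  open import Relation.Binary.PropositionalEquality
  open PeriodicExtension using (det)
  open FareySet using (InFarey; numerator≤denominator; one-greatest)

  from-difference : ∀ p q → p - q ≡ + 1 → p ≡ + 1 + q
  from-difference p q eq = trans (add-back p q) (cong (λ t → t + q) eq)
    where
    add-back : ∀ p q → p ≡ p - q + q
    add-back = solve-∀

  gap : ∀ {p q} → q ℤ.< p → + 1 ℤ.≤ p - q
  gap {p} {q} q<p = subst (ℤ._≤ p - q) (cancel q) (ℤP.+-monoˡ-≤ (- q) (ℤP.i<j⇒suc[i]≤j q<p))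
    where
    cancel : ∀ q → + 1 + q - q ≡ + 1
    cancel = solve-∀

  positive : ∀ {x} → 0ℤ ℤ.< x → Σ ℕ λ X → x ≡ + suc X
  positive {+ zero} (+<+ ())
  positive {+ suc X} _ = X , refl

  to-ℤ : ∀ u a v B → 1 ℕ.+ v ℕ.* B ≡ u ℕ.* a → + 1 + + v * + B ≡ + u * + a
  to-ℤ u a v B eq = trans (cong (λ t → + 1 + t) (sym (ℤP.pos-* v B))) (trans (cong +_ eq) (ℤP.pos-* u a))

  bezout : ∀ a B → Coprime a B → Σ ℤ λ x₀ → Σ ℤ λ y₀ → + B * x₀ - + a * y₀ ≡ + 1
  bezout a B coprime with Coprimality.coprime-Bézout coprime
  ... | Bézout.Identity.+- u v eq = - + v , - + u , (begin
    + B * - + v - + a * - + u      ≡⟨ swap-signs (+ a) (+ B) (+ u) (+ v) ⟩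
    + u * + a - + v * + B          ≡⟨ cong (_- + v * + B) (to-ℤ u a v B eq) ⟨
    + 1 + + v * + B - + v * + B    ≡⟨ cancel (+ v * + B) ⟩
    + 1                            ∎)
    where
    open ≡-Reasoning
    swap-signs : ∀ a B u v → B * - v - a * - u ≡ u * a - v * B
    swap-signs = solve-∀
    cancel : ∀ t → + 1 + t - t ≡ + 1
    cancel = solve-∀
  ... | Bézout.Identity.-+ u v eq = + v , + u , (begin
    + B * + v - + a * + u          ≡⟨ commute (+ a) (+ B) (+ u) (+ v) ⟩
    + v * + B - + u * + a          ≡⟨ cong (_- + u * + a) (to-ℤ v B u a eq) ⟨
    + 1 + + u * + a - + u * + a    ≡⟨ cancel (+ u * + a) ⟩
    + 1                            ∎)
    where
    open ≡-Reasoning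
    commute : ∀ a B u v → B * v - a * u ≡ v * B - u * a
    commute = solve-∀
    cancel : ∀ t → + 1 + t - t ≡ + 1
    cancel = solve-∀

  window : ∀ y₀ B Q .{{_ : ℕ.NonZero B}} → B ℕ.≤ Q →
           Σ ℤ λ m → Σ ℕ λ Y → (y₀ + m * + B ≡ + suc Y) × (Q ℕ.< suc Y ℕ.+ B) × (suc Y ℕ.≤ Q)
  window y₀ B Q B≤Q with ℕP.m≤n⇒∃[o]m+o≡n (ℕP.≤-trans (n%ℕd<d (+ Q - y₀) B) B≤Q)
  ... | Y , r+Y≡Q = m , Y , shifted , above , below
    where
    open ≡-Reasoning
    r = (+ Q - y₀) %ℕ B
    m = (+ Q - y₀) /ℕ B
    Q≡Y+r : suc Y ℕ.+ r ≡ Q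
    Q≡Y+r = trans (cong suc (ℕP.+-comm Y r)) r+Y≡Q
    solve-for-y₀ : ∀ y₀ Q t → y₀ + t ≡ Q - ((Q - y₀) - t)
    solve-for-y₀ = solve-∀
    cancel : ∀ Y r t → Y + r - ((r + t) - t) ≡ Y
    cancel = solve-∀
    shifted : y₀ + m * + B ≡ + suc Y
    shifted = begin
      y₀ + m * + B                                 ≡⟨ solve-for-y₀ y₀ (+ Q) (m * + B) ⟩
      + Q - ((+ Q - y₀) - m * + B)                 ≡⟨ cong (λ t → + Q - (t - m * + B)) (a≡a%ℕn+[a/ℕn]*n (+ Q - y₀) B) ⟩
      + Q - ((+ r + m * + B) - m * + B)            ≡⟨ cong (λ n → + n - ((+ r + m * + B) - m * + B)) (sym Q≡Y+r) ⟩
      + suc Y + + r - ((+ r + m * + B) - m * + B)  ≡⟨ cancel (+ suc Y) (+ r) (m * + B) ⟩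
      + suc Y                                      ∎
    above : Q ℕ.< suc Y ℕ.+ B
    above = subst (ℕ._< suc Y ℕ.+ B) Q≡Y+r (ℕP.+-monoʳ-< (suc Y) (n%ℕd<d (+ Q - y₀) B))
    below : suc Y ℕ.≤ Q
    below = subst (suc Y ℕ.≤_) Q≡Y+r (ℕP.m≤m+n (suc Y) r)

  bezout-window : ∀ a B Q .{{_ : ℕ.NonZero B}} → Coprime a B → B ℕ.≤ Q →
    Σ ℕ λ X → Σ ℕ λ Y → (+ suc X * + B - + a * + suc Y ≡ + 1) × (Q ℕ.< suc Y ℕ.+ B) × (suc Y ℕ.≤ Q)
  bezout-window a B Q coprime B≤Q with bezout a B coprime
  ... | x₀ , y₀ , bezout-eq with window y₀ B Q B≤Q
  ... | m , Y , y₀+mB≡y , above , below = X , Y , subst (λ x → x * + B - + a * + suc Y ≡ + 1) x≡X solution , above , below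
    where
    open ≡-Reasoning
    x = x₀ + + a * m
    shift : ∀ a B x₀ y₀ m → (x₀ + a * m) * B - a * (y₀ + m * B) ≡ B * x₀ - a * y₀
    shift = solve-∀
    solution : x * + B - + a * + suc Y ≡ + 1
    solution = begin
      x * + B - + a * + suc Y              ≡⟨ cong (λ y → x * + B - + a * y) (sym y₀+mB≡y) ⟩
      x * + B - + a * (y₀ + m * + B)       ≡⟨ shift (+ a) (+ B) x₀ y₀ m ⟩
      + B * x₀ - + a * y₀                  ≡⟨ bezout-eq ⟩
      + 1                                  ∎
    x-positive : 0ℤ ℤ.< x
    x-positive = ℤP.*-cancelʳ-<-nonNeg (+ B) (subst (0ℤ ℤ.<_) (sym (from-difference (x * + B) (+ a * + suc Y) solution))
                   (subst (λ t → 0ℤ ℤ.< + 1 + t) (ℤP.pos-* a (suc Y)) (+<+ (ℕ.s≤s ℕ.z≤n))))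
    X = proj₁ (positive x-positive)
    x≡X = proj₂ (positive x-positive)

  coprime-of-det : ∀ a B X Y → + X * + B - + a * + Y ≡ + 1 → Coprime X Y
  coprime-of-det a B X Y eq {d} (d∣X , d∣Y) =
    ∣1⇒≡1 (∣m+n∣m⇒∣n (subst (d ∣_) XB≡aY+1 (∣m⇒∣m*n B d∣X)) (∣n⇒∣m*n a d∣Y))
    where
    open ≡-Reasoning
    XB≡aY+1 : X ℕ.* B ≡ a ℕ.* Y ℕ.+ 1
    XB≡aY+1 = ℤP.+-injective (begin
      + (X ℕ.* B)          ≡⟨ ℤP.pos-* X B ⟩
      + X * + B            ≡⟨ from-difference (+ X * + B) (+ a * + Y) eq ⟩
      + 1 + + a * + Y      ≡⟨ ℤP.+-comm (+ 1) (+ a * + Y) ⟩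
      + a * + Y + + 1      ≡⟨ cong (λ t → t + + 1) (ℤP.pos-* a Y) ⟨
      + (a ℕ.* Y ℕ.+ 1)    ∎)

  between-neighbours : ∀ a c d x (b y : ℕ) → x * + b - a * + y ≡ + 1 →
                       a * d ℤ.< c * + b → c * + y ℤ.< x * d → + b + + y ℤ.≤ d
  between-neighbours a c d x b y unimodular a/b<c/d c/d<x/y = begin
    + b + + y                  ≡⟨ cong₂ _+_ (ℤP.*-identityʳ (+ b)) (ℤP.*-identityʳ (+ y)) ⟨
    + b * + 1 + + y * + 1      ≤⟨ ℤP.+-mono-≤ (ℤP.*-monoˡ-≤-nonNeg (+ b) (gap c/d<x/y))
                                              (ℤP.*-monoˡ-≤-nonNeg (+ y) (gap a/b<c/d)) ⟩
    + b * (x * d - c * + y) + + y * (c * + b - a * d)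
                               ≡⟨ expand (+ b) (+ y) a c d x ⟩
    d * (x * + b - a * + y)    ≡⟨ cong (d *_) unimodular ⟩
    d * + 1                    ≡⟨ ℤP.*-identityʳ d ⟩
    d                          ∎
    where
    open ℤP.≤-Reasoning
    expand : ∀ b y a c d x → b * (x * d - c * y) + y * (c * b - a * d) ≡ d * (x * b - a * y)
    expand = solve-∀

  -- The Bézout fraction z = x/y of the window lies to the right of A,
  -- cannot lie strictly between A and C, and cannot lie beyond C (its denominator would
  -- force d ≥ b + y > Q); hence z = C.
  neighbours-unimodular : ∀ Q {A C} → InFarey Q A → InFarey Q C → A ℚ.< C →
    (∀ z → InFarey Q z → z ℚ.≤ A ⊎ C ℚ.≤ z) → det A C ≡ + 1
  neighbours-unimodular Q {mkℚ -[1+ _ ] _ _} (() , _) _ _ _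
  neighbours-unimodular Q {A@(mkℚ (+ a) b′ coprime)} {C} (_ , _ , +≤+ B≤Q) C∈F A<C nothing-between
    = via-window (bezout-window a (suc b′) Q (Coprimality.recompute coprime) B≤Q)
    where
    via-window : (Σ ℕ λ X → Σ ℕ λ Y → (+ suc X * + suc b′ - + a * + suc Y ≡ + 1) ×
                   (Q ℕ.< suc Y ℕ.+ suc b′) × (suc Y ℕ.≤ Q)) → det A C ≡ + 1
    via-window (X , Y , unimodular , above , below) = compare (ℚP.<-cmp z C)
      where
      z : ℚ
      z = mkℚ (+ suc X) Y (coprime-of-det a (suc b′) (suc X) (suc Y) unimodular)
      A<z : A ℚ.< z
      A<z = *<* (subst (+ a * + suc Y ℤ.<_) (sym (from-difference (+ suc X * + suc b′) (+ a * + suc Y) unimodular))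
                  (ℤP.suc[i]≤j⇒i<j ℤP.≤-refl))
      compare : Tri (z ℚ.< C) (z ≡ C) (C ℚ.< z) → det A C ≡ + 1
      -- z < C: z would be a Farey fraction strictly between A and C.
      compare (tri< z<C _ _) = ⊥-elim (excluded (nothing-between z z∈F))
        where
        z∈F : InFarey Q z
        z∈F = +≤+ (ℕ.s≤s ℕ.z≤n) , numerator≤denominator (ℚP.≤-trans (ℚP.<⇒≤ z<C) (one-greatest C∈F)) , +≤+ below
        excluded : z ℚ.≤ A ⊎ C ℚ.≤ z → ⊥
        excluded (inj₁ z≤A) = ℚP.<-irrefl refl (ℚP.<-≤-trans A<z z≤A)
        excluded (inj₂ C≤z) = ℚP.<-irrefl refl (ℚP.≤-<-trans C≤z z<C)
      compare (tri≈ _ z≡C _) = subst (λ C → det A C ≡ + 1) z≡C unimodular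
      -- C < z: C lies strictly between the unimodular pair A, z, so d ≥ b + y > Q.
      compare (tri> _ _ C<z) = ⊥-elim (ℕP.<⇒≱ above (subst (ℕ._≤ Q) (ℕP.+-comm (suc b′) (suc Y)) B+y≤Q))
        where
        B+y≤Q : suc b′ ℕ.+ suc Y ℕ.≤ Q
        B+y≤Q = ℤP.drop‿+≤+ (ℤP.≤-trans
          (between-neighbours (+ a) (↥ C) (↧ C) (+ suc X) (suc b′) (suc Y) unimodular (ℚP.drop-*<* A<C) (ℚP.drop-*<* C<z))
          (proj₂ (proj₂ C∈F)))

module FareySequence where

  open import Data.Nat as ℕ using (suc)
  open import Data.Integer using (+_)
  open import Data.Rational as ℚ using (ℚ; ↥_; 1ℚ)
  import Data.Rational.Properties as ℚP
  open import Data.List using ([]; _∷_; length)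
  open import Data.List.Relation.Unary.Linked using (Linked)
  open import Data.List.Relation.Unary.Unique.Propositional using (Unique)
  open import Data.List.Membership.Propositional using (_∈_)
  open import Data.List.Relation.Unary.Any using (here)
  open import Data.Empty using (⊥; ⊥-elim)
  open import Relation.Binary.PropositionalEquality
  open ContinuantFormula using (Unimodular; unimodular-resp)
  open PeriodicExtension using (det; numer; denom; pFar≡numer; qFar≡denom; periodic-unimodular)
  open SortedLists
  open FareySet
  open FareyNeighbours using (neighbours-unimodular)

  -- The list farey Q satisfies the hypotheses of periodic-unimodular: consecutive entries
  -- are neighbours, the first entry is 1/Q and the last is 1.
  farey-list-unimodular : ∀ Q → 1 ℕ.≤ Q → Unimodular (numer (farey Q)) (denom (farey Q))
  farey-list-unimodular (suc Q′) Q≥1 with farey (suc Q′) in eq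
  ... | [] = ⊥-elim (empty (subst (1ℚ ∈_) eq (InFarey⇒∈farey (one-InFarey _ Q≥1))))
    where
    empty : 1ℚ ∈ [] → ⊥
    empty ()
  ... | x ∷ xs = periodic-unimodular x xs consecutive head-numerator last≡1
    where
    Q = suc Q′
    γ = lookupD x xs
    sorted : Linked ℚ._≤_ (x ∷ xs)
    sorted = subst (Linked ℚ._≤_) eq (farey-sorted Q)
    unique : Unique (x ∷ xs)
    unique = subst Unique eq (farey-unique Q)
    entry⇒InFarey : ∀ {z} → z ∈ x ∷ xs → InFarey Q z
    entry⇒InFarey {z} z∈ = ∈farey⇒InFarey (subst (z ∈_) (sym eq) z∈)
    InFarey⇒entry : ∀ {z} → InFarey Q z → z ∈ x ∷ xs
    InFarey⇒entry {z} z∈F = subst (z ∈_) eq (InFarey⇒∈farey z∈F)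
    consecutive : ∀ r → suc r ℕ.< suc (length xs) → det (γ r) (γ (suc r)) ≡ + 1
    consecutive r r+1<N = neighbours-unimodular Q (entry⇒InFarey (lookup∈ x xs r)) (entry⇒InFarey (lookup∈ x xs (suc r)))
      (consecutive-< sorted unique r r+1<N) (λ z z∈F → no-entry-between sorted r r+1<N (InFarey⇒entry z∈F))
    head-numerator : ↥ x ≡ + 1
    head-numerator = cong ↥_ (ℚP.≤-antisym (head-least sorted (InFarey⇒entry (reciprocal-InFarey Q′)))
                                          (reciprocal-least (entry⇒InFarey (here refl))))
    last≡1 : γ (length xs) ≡ 1ℚ
    last≡1 = ℚP.≤-antisym (one-greatest (entry⇒InFarey (lookup∈ x xs (length xs))))
                          (last-greatest sorted (InFarey⇒entry (one-InFarey Q Q≥1)))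

  farey-unimodular : ∀ Q → 1 ℕ.≤ Q → Unimodular (pFar Q) (qFar Q)
  farey-unimodular Q Q≥1 = unimodular-resp (pFar≡numer Q) (qFar≡denom Q) (farey-list-unimodular Q Q≥1)

open import Data.Nat using (ℕ; _≥_; _∸_; _*_)
open import Data.Integer using (ℤ; +_; _+_; _-_) renaming (_*_ to _*ℤ_)
open import Relation.Binary.PropositionalEquality using (_≡_)

theorem1 : (Q : ℕ) → Q ≥ 1 → (k : ℕ) → k ≥ 1 → (i : ℤ) →
    ν Q k i ≡ kron2 (2 * k ∸ 1) *ℤ K (k ∸ 1) (λ j → sgn j *ℤ ν Q 2 (i + + j - + 1))
theorem1 Q Q≥1 k k≥1 i = index-formula {P = pFar Q} {R = qFar Q} (farey-unimodular Q Q≥1) k k≥1 i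
  where
  -- ν Q k i is by definition the index-k determinant of the sequence (pFar Q, qFar Q).
  open ContinuantFormula using (index-formula)
  open FareySequence using (farey-unimodular)
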